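{- Let $\mu$ be a nonempty partition. Then $d(\mu)>1$ if and only if $\ell(\mu^{rc})=\ell(\mu)$, and $d(\mu)=1$ if and only if $\ell(\mu^{rc})=0$.
   Context: $\ell(\lambda)$ is the number of nonzero parts of a partition; set $\lambda_t=0$ for $t>\ell(\lambda)$; $d(\lambda)$ is the largest $i\ge1$ with $\lambda_i\ge i$ (length of the diagonal). The Maya diagram of $\lambda$ is $S(\lambda)=\{\lambda_t-t+\tfrac12:t\ge1\}$. For $S\subseteq\mathbb{Z}+\tfrac12$ let $S^+=\{x\in S:x>0\}$, $S^-=\{x\in(\mathbb{Z}+\tfrac12)\setminus S:x<0\}$; if finite, $c(S)=|S^+|-|S^-|$ and $\{s-c(S):s\in S\}$ is the Maya diagram of a unique partition, the partition associated to $S$. For nonempty $\mu$ with $S=S(\mu)$, $\mu^{rc}$ is the partition associated to $(S\setminus\{\min S^+\})\cup\{\max S^-\}$ (equivalently, the partition obtained from $\mu$ by removing the hook of the cell $(d(\mu),d(\mu))$). -}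

module Defs where

open import Data.Nat using (ℕ; zero; suc; _≤_; _<_; _≥_; _∸_; _⊔_; _⊓_; _≤?_; _<?_)
open import Data.List using (List; []; _∷_; length; filter; map; foldr; upTo)
open import Data.List.Relation.Unary.All using (All)
open import Data.List.Relation.Unary.Linked using (Linked)
open import Relation.Nullary.Decidable using (does)
open import Data.Bool using (if_then_else_)

IsPartition : List ℕ → Set
IsPartition μ = Linked _≥_ μ × All (λ x → 0 < x) μ
  where open import Data.Product using (_×_)

-- λ_t (1-indexed), with λ_t = 0 for t > ℓ(λ) (and t = 0 also gives 0).
part : List ℕ → ℕ → ℕ
part []       _             = 0
part (x ∷ xs) zero          = 0
part (x ∷ xs) (suc zero)    = x
part (x ∷ xs) (suc (suc t)) = part xs (suc t)

ℓ : List ℕ → ℕ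
ℓ μ = length (filter (λ x → 0 <? x) μ)

-- d(λ): the largest i ≥ 1 with λ_i ≥ i (0 if there is none, i.e. λ empty).
-- Any such i satisfies i ≤ λ_i, hence i ≤ ℓ(λ) (λ_i ≠ 0), so it suffices
-- to range over i ∈ {1, …, length λ}.
d : List ℕ → ℕ
d μ = foldr _⊔_ 0
        (map (λ j → let i = suc j in
                    if does (i ≤? part μ i) then i else 0)
             (upTo (length μ)))

-- μ^{rc}: μ with the hook of the cell (d,d) removed, d = d(μ).
-- Since μ_{d+1} ≤ d there are no cells (i,j) with i,j > d, so removing the
-- hook {(d,j) : j ≥ d} ∪ {(i,d) : i > d} leaves a Young diagram whose rows are
--   row i = μ_i                 for i < d,
--   row i = min(μ_i, d - 1)     for i ≥ d   (row d has exactly d - 1 cells).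
-- We list rows 1 … length μ (later rows are empty); possible trailing zeros
-- are not counted by ℓ.
rcRow : List ℕ → ℕ → ℕ
rcRow μ i = if does (i <? d μ) then part μ i else (part μ i ⊓ (d μ ∸ 1))

rc : List ℕ → List ℕ
rc μ = map (λ j → rcRow μ (suc j)) (upTo (length μ))

module Submission where

open import Defs
open import Data.Nat using (ℕ; zero; suc; _<_; _≤_; _<?_; _≤?_; _⊓_; _⊔_; _∸_; z≤n; s≤s; z<s)
open import Data.Nat.Properties using (m≤m⊔n; ⊓-zeroʳ; ∸-monoˡ-≤; m≤n⇒m<n∨m≡n; 0≢1+n)
open import Data.List using (List; []; _∷_; length; map; upTo; applyUpTo; foldr)
open import Data.List.Properties using (length-map; length-upTo; filter-all; filter-none)
open import Data.List.Relation.Unary.All as All using (All; _∷_; universal)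
open import Data.List.Relation.Unary.All.Properties using (map⁺; applyUpTo⁺₁)
open import Data.Product using (_×_; _,_)
open import Data.Sum using (_⊎_; inj₁; inj₂)
open import Data.Empty using (⊥-elim)
open import Function.Bundles using (_⇔_; mk⇔)
open import Relation.Binary.PropositionalEquality
  using (_≡_; _≢_; refl; sym; trans; cong; subst; module ≡-Reasoning)
open import Relation.Nullary using (yes; no; ¬_)
open import Relation.Nullary.Decidable using (does; dec-true; dec-false)
open import Data.Bool using (if_then_else_)

-- Rows 1, …, d−1 of μ^{rc} are rows of μ and rows i ≥ d are min(μ_i, d−1).
-- If d > 1 every row is positive, so μ^{rc} keeps all ℓ(μ) rows; if d = 1
-- the first case is empty and every row is min(μ_i, 0) = 0.

ℓ-all-positive : ∀ {xs} → All (0 <_) xs → ℓ xs ≡ length xs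
ℓ-all-positive ps = cong length (filter-all (0 <?_) ps)

ℓ-all-zero : ∀ {xs} → All (_≡ 0) xs → ℓ xs ≡ 0
ℓ-all-zero zs = cong length (filter-none (0 <?_) (All.map (λ { refl () }) zs))

part-positive : ∀ {μ} → All (0 <_) μ → ∀ {j} → j < length μ → 0 < part μ (suc j)
part-positive (p ∷ _)  {zero}  _       = p
part-positive (_ ∷ ps) {suc j} (s≤s j<n) = part-positive ps j<n

part-zero : ∀ μ → part μ 0 ≡ 0
part-zero []      = refl
part-zero (_ ∷ _) = refl

1≤d : ∀ {x} xs → 0 < x → 1 ≤ d (x ∷ xs)
1≤d {x@(suc _)} xs _ = m≤m⊔n 1 (foldr _⊔_ 0 (map diagonalIndex (applyUpTo suc (length xs))))
  where
  diagonalIndex : ℕ → ℕ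
  diagonalIndex j = if does (suc j ≤? part (x ∷ xs) (suc j)) then suc j else 0

length-rc : ∀ μ → length (rc μ) ≡ length μ
length-rc μ = trans (length-map _ (upTo (length μ))) (length-upTo (length μ))

rcRow-below : ∀ μ i → i < d μ → rcRow μ i ≡ part μ i
rcRow-below μ i i<d = cong (if_then part μ i else (part μ i ⊓ (d μ ∸ 1))) (dec-true (i <? d μ) i<d)

rcRow-above : ∀ μ i → ¬ i < d μ → rcRow μ i ≡ part μ i ⊓ (d μ ∸ 1)
rcRow-above μ i i≮d = cong (if_then part μ i else (part μ i ⊓ (d μ ∸ 1))) (dec-false (i <? d μ) i≮d)

rcRow-positive : ∀ μ i → 1 < d μ → 0 < part μ i → 0 < rcRow μ i
rcRow-positive μ i 1<d 0<μᵢ with i <? d μ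
... | yes i<d = subst (0 <_) (sym (rcRow-below μ i i<d)) 0<μᵢ
... | no  i≮d = subst (0 <_) (sym (rcRow-above μ i i≮d)) (⊓-positive 0<μᵢ (∸-monoˡ-≤ 1 1<d))
  where
  ⊓-positive : ∀ {a b} → 0 < a → 0 < b → 0 < a ⊓ b
  ⊓-positive {suc _} {suc _} _ _ = z<s

rcRow-zero : ∀ μ i → d μ ≡ 1 → rcRow μ i ≡ 0
rcRow-zero μ i d≡1 with i <? d μ
... | yes i<d with subst (i <_) d≡1 i<d
...   | s≤s z≤n = trans (rcRow-below μ 0 i<d) (part-zero μ)
rcRow-zero μ i d≡1 | no i≮d = begin
  rcRow μ i                ≡⟨ rcRow-above μ i i≮d ⟩
  part μ i ⊓ (d μ ∸ 1)     ≡⟨ cong (λ k → part μ i ⊓ (k ∸ 1)) d≡1 ⟩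
  part μ i ⊓ 0             ≡⟨ ⊓-zeroʳ (part μ i) ⟩
  0                        ∎
  where open ≡-Reasoning

ℓ-rc-of-1<d : ∀ μ → All (0 <_) μ → 1 < d μ → ℓ (rc μ) ≡ ℓ μ
ℓ-rc-of-1<d μ ps 1<d = begin
  ℓ (rc μ)      ≡⟨ ℓ-all-positive rows-positive ⟩
  length (rc μ) ≡⟨ length-rc μ ⟩
  length μ      ≡⟨ sym (ℓ-all-positive ps) ⟩
  ℓ μ           ∎
  where
  open ≡-Reasoning
  rows-positive : All (0 <_) (rc μ)
  rows-positive = map⁺ (applyUpTo⁺₁ _ (length μ)
    (λ j<n → rcRow-positive μ _ 1<d (part-positive ps j<n)))

ℓ-rc-of-d≡1 : ∀ μ → d μ ≡ 1 → ℓ (rc μ) ≡ 0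
ℓ-rc-of-d≡1 μ d≡1 = ℓ-all-zero (map⁺ (universal (λ _ → rcRow-zero μ _ d≡1) (upTo (length μ))))

lemma5p34 : (μ : List ℕ) → IsPartition μ → μ ≢ [] →
    ((1 < d μ) ⇔ (ℓ (rc μ) ≡ ℓ μ)) × ((d μ ≡ 1) ⇔ (ℓ (rc μ) ≡ 0))
lemma5p34 []                _                   μ≢[] = ⊥-elim (μ≢[] refl)
lemma5p34 μ@(_ ∷ xs) (_ , ps@(0<x ∷ _)) _ =
  mk⇔ (ℓ-rc-of-1<d μ ps) from-ℓ-rc≡ℓ , mk⇔ (ℓ-rc-of-d≡1 μ) from-ℓ-rc≡0
  where
  1<d⊎1≡d : 1 < d μ ⊎ 1 ≡ d μ
  1<d⊎1≡d = m≤n⇒m<n∨m≡n (1≤d xs 0<x)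

  ℓμ≢0 : ℓ μ ≢ 0
  ℓμ≢0 ℓμ≡0 = 0≢1+n (trans (sym ℓμ≡0) (ℓ-all-positive ps))

  from-ℓ-rc≡ℓ : ℓ (rc μ) ≡ ℓ μ → 1 < d μ
  from-ℓ-rc≡ℓ ℓrc≡ℓμ with 1<d⊎1≡d
  ... | inj₁ 1<d = 1<d
  ... | inj₂ 1≡d = ⊥-elim (ℓμ≢0 (trans (sym ℓrc≡ℓμ) (ℓ-rc-of-d≡1 μ (sym 1≡d))))

  from-ℓ-rc≡0 : ℓ (rc μ) ≡ 0 → d μ ≡ 1
  from-ℓ-rc≡0 ℓrc≡0 with 1<d⊎1≡d
  ... | inj₁ 1<d = ⊥-elim (ℓμ≢0 (trans (sym (ℓ-rc-of-1<d μ ps 1<d)) ℓrc≡0))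
  ... | inj₂ 1≡d = sym 1≡d
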